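{- Let $w$ be a string of length $n$ with suffix array $r$ and longest-common-prefix array $LCP$. A substring $u$ of $w$ is supermaximal to the right if and only if there exist an index $i\ge 1$ and an integer $k\ge 2$ with $i+k-1\le n$ such that $u$ is the prefix of length $LCP[i]$ of $w[r[i]..n]$, $LCP[i]=LCP[i+1]=\dots=LCP[i+k-2]$, ($i=1$ or $LCP[i-1]<LCP[i]$), and ($i+k-1=n$ or $LCP[i+k-1]<LCP[i]$); that is, $u$ is the common prefix of the suffixes addressed by a maximal run of consecutive suffix-array indices forming a local maximum of $LCP$.
   Context: Positions of $w$ are numbered $1,\dots,n$, and $w[i..j]$ is the substring from position $i$ to $j$ inclusive. A string $u$ occurs in $w$ at position $i$ if $u=w[i..i+|u|-1]$. An extension to the right of $u$ is a string $uv$ with $v$ nonempty. A substring $u$ that occurs more than once in $w$ is supermaximal to the right if every extension to the right of $u$ occurs at most once in $w$. The suffix array $r$ of $w$ is the permutation of $\{1,\dots,n\}$ such that $w[r[i]..n]$ is lexicographically smaller than $w[r[j]..n]$ whenever $i<j$; for $1\le i<n$, $LCP[i]$ is the length of the longest common prefix of $w[r[i]..n]$ and $w[r[i+1]..n]$. -}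

module Defs where

open import Data.Nat using (ℕ; zero; suc; _+_; _∸_; _≤_; _<_)
open import Data.List using (List; []; _∷_; length; take; drop; _++_)
open import Data.Product using (Σ; _×_; _,_; ∃)
open import Data.Sum using (_⊎_)
open import Relation.Nullary using (¬_; yes; no)
open import Relation.Binary.Core using (Rel)
open import Level using (0ℓ)
open import Relation.Binary.Definitions using (DecidableEquality)
open import Relation.Binary.PropositionalEquality using (_≡_)
open import Data.List.Relation.Binary.Lex.Core using (Lex-<)

-- Strings are lists over an alphabet A.  Positions are 1-based, as in
-- the paper: position p of w (1 ≤ p ≤ n = length w).

module _ {A : Set} where

  suffix : List A → ℕ → List A
  suffix w p = drop (p ∸ 1) w

  OccursAt : List A → List A → ℕ → Set
  OccursAt w u i =
    1 ≤ i × i ≤ length w × (i + length u ∸ 1 ≤ length w)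
      × u ≡ take (length u) (suffix w i)

  IsSubstring : List A → List A → Set
  IsSubstring u w = ∃ λ i → OccursAt w u i

  OccursMoreThanOnce : List A → List A → Set
  OccursMoreThanOnce w u =
    Σ ℕ λ i → Σ ℕ λ j → ¬ (i ≡ j) × OccursAt w u i × OccursAt w u j

  OccursAtMostOnce : List A → List A → Set
  OccursAtMostOnce w u = ∀ i j → OccursAt w u i → OccursAt w u j → i ≡ j

  SupermaximalRight : List A → List A → Set
  SupermaximalRight w u =
    OccursMoreThanOnce w u ×
    (∀ (v : List A) → ¬ (v ≡ []) → OccursAtMostOnce w (u ++ v))

  record IsSuffixArray (_≺_ : Rel A 0ℓ) (w : List A) (r : ℕ → ℕ) : Set where
    field
      range  : ∀ i → 1 ≤ i → i ≤ length w → 1 ≤ r i × r i ≤ length w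
      inj    : ∀ i j → 1 ≤ i → i ≤ length w → 1 ≤ j → j ≤ length w →
               r i ≡ r j → i ≡ j
      sorted : ∀ i j → 1 ≤ i → i < j → j ≤ length w →
               Lex-< _≡_ _≺_ (suffix w (r i)) (suffix w (r j))

  lcp : DecidableEquality A → List A → List A → ℕ
  lcp _≟_ [] ys = 0
  lcp _≟_ (x ∷ xs) [] = 0
  lcp _≟_ (x ∷ xs) (y ∷ ys) with x ≟ y
  ... | yes _ = suc (lcp _≟_ xs ys)
  ... | no _ = 0

  -- LCP[i] = lcp of w[r[i]..n] and w[r[i+1]..n]   (meaningful for 1 ≤ i < n)
  LCP : DecidableEquality A → List A → (ℕ → ℕ) → ℕ → ℕ
  LCP _≟_ w r i = lcp _≟_ (suffix w (r i)) (suffix w (r (suc i)))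

module Submission where

-- Let S j = w[r[j]..n] be the j-th smallest suffix.  Occurrences of u
-- correspond to the indices j with u a prefix of S j (r is a permutation,
-- as an injection of {1..n} into itself); these indices form an interval,
-- because the suffixes are sorted; and u prefixes both S m and S (m+1)
-- iff |u| ≤ LCP[m].  If u is supermaximal, the maximal run [i,b] of such
-- indices has i < b and LCP[m] = |u| on [i,b): a larger value would make
-- the common prefix of S m and S (m+1) a proper extension of u occurring
-- twice; the LCP drops at both ends say that the run is maximal.
-- Conversely such an LCP run is exactly the index interval of u, and a
-- proper extension starting two of its suffixes would give LCP[m] > |u|.
-- The file treats prefixes and lcp of lists, lexicographic convexity,
-- finite injections, maximal runs of a decidable predicate, and then the
-- suffix array; the theorem last translates b into the paper's i + k - 1.

open import Data.Nat using (ℕ; zero; suc; _+_; _∸_; _≤_; _<_; z≤n; s≤s; pred)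
open import Data.Nat.Properties
open import Data.Fin using (Fin; toℕ; fromℕ<; punchOut)
open import Data.Fin.Properties
  using (toℕ-fromℕ<; toℕ<n; toℕ-injective; punchOut-injective; any?; injective⇒≤)
  renaming (_≟_ to _≟ᶠ_)
open import Data.List using (List; []; _∷_; length; take; drop; _++_)
open import Data.List.Properties using (length-take; length-drop; take++drop≡id)
open import Data.List.Relation.Binary.Prefix.Heterogeneous using (Prefix; []; _∷_)
open import Data.List.Relation.Binary.Prefix.Heterogeneous.Properties
  using (prefix?; length-mono) renaming (trans to prefix-trans)
open import Data.List.Relation.Binary.Prefix.Propositional.Properties using (∣ˡ-as-Prefix)
open import Data.List.Relation.Binary.Lex.Core using (Lex-<; this; next)
open import Data.Product using (Σ; _×_; _,_; ∃; proj₁; proj₂)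
open import Data.Sum using (_⊎_; inj₁; inj₂; map₁; map₂)
open import Data.Empty using (⊥; ⊥-elim)
open import Relation.Nullary using (¬_; yes; no; contradiction)
open import Relation.Unary using (Decidable)
open import Relation.Binary.Core using (Rel)
open import Relation.Binary.Definitions
  using (DecidableEquality; Irreflexive; Transitive; tri<; tri≈; tri>)
open import Level using (0ℓ)
open import Relation.Binary.Structures using (IsStrictTotalOrder)
open import Relation.Binary.PropositionalEquality
  using (_≡_; _≢_; refl; sym; trans; cong; subst)
open import Function.Definitions using (Injective)
open import Function.Bundles using (_⇔_; mk⇔; Equivalence)

open import Defs

-- Prefixes of lists

module _ {A : Set} where

  infix 4 _≼_

  _≼_ : List A → List A → Set
  _≼_ = Prefix _≡_

  prefix⇒take : ∀ {u xs} → u ≼ xs → u ≡ take (length u) xs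
  prefix⇒take [] = refl
  prefix⇒take (refl ∷ p) = cong (_ ∷_) (prefix⇒take p)

  take-prefix : ∀ m xs → take m xs ≼ xs
  take-prefix m xs = ∣ˡ-as-Prefix record { quotient = drop m xs ; equality = take++drop≡id m xs }

  take⇒prefix : ∀ {u xs} → u ≡ take (length u) xs → u ≼ xs
  take⇒prefix {u} {xs} e = subst (_≼ xs) (sym e) (take-prefix (length u) xs)

  prefix-++ : ∀ u v → u ≼ u ++ v
  prefix-++ u v = ∣ˡ-as-Prefix record { quotient = v ; equality = refl }

  prefix-comparable : ∀ {u v xs} → u ≼ xs → v ≼ xs → length u ≤ length v → u ≼ v
  prefix-comparable [] _ _ = []
  prefix-comparable (refl ∷ p) (refl ∷ q) (s≤s le) = refl ∷ prefix-comparable p q le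

  proper-extension : ∀ {u v} → u ≼ v → length u < length v →
                     Σ (List A) λ s → s ≢ [] × v ≡ u ++ s
  proper-extension {v = y ∷ ys} [] _ = y ∷ ys , (λ ()) , refl
  proper-extension (refl ∷ p) (s≤s lt) with proper-extension p lt
  ... | s , s≢[] , e = s , s≢[] , cong (_ ∷_) e

  ++-longer : ∀ u {v : List A} → v ≢ [] → length u < length (u ++ v)
  ++-longer [] {[]} v≢[] = contradiction refl v≢[]
  ++-longer [] {_ ∷ _} _ = s≤s z≤n
  ++-longer (_ ∷ u) v≢[] = s≤s (++-longer u v≢[])

-- Longest common prefixes

module _ {A : Set} (_≟_ : DecidableEquality A) where

  commonPrefix : List A → List A → List A
  commonPrefix xs ys = take (lcp _≟_ xs ys) xs

  lcp≤length : ∀ xs ys → lcp _≟_ xs ys ≤ length xs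
  lcp≤length [] ys = z≤n
  lcp≤length (x ∷ xs) [] = z≤n
  lcp≤length (x ∷ xs) (y ∷ ys) with x ≟ y
  ... | yes _ = s≤s (lcp≤length xs ys)
  ... | no _ = z≤n

  length-commonPrefix : ∀ xs ys → length (commonPrefix xs ys) ≡ lcp _≟_ xs ys
  length-commonPrefix xs ys =
    trans (length-take (lcp _≟_ xs ys) xs) (m≤n⇒m⊓n≡m (lcp≤length xs ys))

  commonPrefix-right : ∀ xs ys → commonPrefix xs ys ≼ ys
  commonPrefix-right [] ys = []
  commonPrefix-right (x ∷ xs) [] = []
  commonPrefix-right (x ∷ xs) (y ∷ ys) with x ≟ y
  ... | yes refl = refl ∷ commonPrefix-right xs ys
  ... | no _ = []

  lcp-greatest : ∀ {t xs ys} → t ≼ xs → t ≼ ys → length t ≤ lcp _≟_ xs ys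
  lcp-greatest [] _ = z≤n
  lcp-greatest {x ∷ _} (refl ∷ p) (refl ∷ q) with x ≟ x
  ... | yes _ = s≤s (lcp-greatest p q)
  ... | no x≢x = contradiction refl x≢x

  short-prefix-common : ∀ {t xs ys} → (t ≼ xs ⊎ t ≼ ys) → length t ≤ lcp _≟_ xs ys →
                        t ≼ commonPrefix xs ys
  short-prefix-common {t} {xs} {ys} (inj₁ p) le =
    prefix-comparable p (take-prefix (lcp _≟_ xs ys) xs) (subst (length t ≤_) (sym (length-commonPrefix xs ys)) le)
  short-prefix-common {t} {xs} {ys} (inj₂ q) le =
    prefix-comparable q (commonPrefix-right xs ys) (subst (length t ≤_) (sym (length-commonPrefix xs ys)) le)

  lcp-transferʳ : ∀ {t xs ys} → t ≼ xs → length t ≤ lcp _≟_ xs ys → t ≼ ys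
  lcp-transferʳ {xs = xs} {ys} p le = prefix-trans trans (short-prefix-common (inj₁ p) le) (commonPrefix-right xs ys)

  lcp-transferˡ : ∀ {t xs ys} → t ≼ ys → length t ≤ lcp _≟_ xs ys → t ≼ xs
  lcp-transferˡ {xs = xs} {ys} q le =
    prefix-trans trans (short-prefix-common (inj₂ q) le) (take-prefix (lcp _≟_ xs ys) xs)

-- Lexicographic convexity of prefix classes

module _ {A : Set} {_≺_ : Rel A 0ℓ} (≺-irrefl : Irreflexive _≡_ _≺_) (≺-trans : Transitive _≺_) where

  prefix-between : ∀ {t xs ys zs} → t ≼ xs → t ≼ zs →
                   Lex-< _≡_ _≺_ xs ys → Lex-< _≡_ _≺_ ys zs → t ≼ ys
  prefix-between [] _ _ _ = []
  prefix-between (refl ∷ _) (refl ∷ _) (this x≺y) (this y≺x) = contradiction (≺-trans x≺y y≺x) (≺-irrefl refl)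
  prefix-between (refl ∷ _) (refl ∷ _) (this x≺x) (next refl _) = contradiction x≺x (≺-irrefl refl)
  prefix-between (refl ∷ _) (refl ∷ _) (next refl _) (this x≺x) = contradiction x≺x (≺-irrefl refl)
  prefix-between (refl ∷ p) (refl ∷ q) (next refl lt₁) (next refl lt₂) = refl ∷ prefix-between p q lt₁ lt₂

-- An injective map from Fin n to itself is onto: otherwise, squeezing
-- out a missed value would inject Fin n into Fin (n - 1).
fin-injective⇒surjective : ∀ {n} (f : Fin n → Fin n) → Injective _≡_ _≡_ f →
                           ∀ y → ∃ λ x → f x ≡ y
fin-injective⇒surjective {suc m} f f-inj y with any? (λ x → f x ≟ᶠ y)
... | yes hit = hit
... | no miss = contradiction (injective⇒≤ squeezed-injective) 1+n≰n
  where
    missed : ∀ x → y ≢ f x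
    missed x y≡fx = miss (x , sym y≡fx)

    squeezed : Fin (suc m) → Fin m
    squeezed x = punchOut (missed x)

    squeezed-injective : Injective _≡_ _≡_ squeezed
    squeezed-injective e = f-inj (punchOut-injective (missed _) (missed _) e)

pred-injective-pos : ∀ {m m′} → 1 ≤ m → 1 ≤ m′ → pred m ≡ pred m′ → m ≡ m′
pred-injective-pos (s≤s z≤n) (s≤s z≤n) e = cong suc e

pred-<-pos : ∀ {m n} → 1 ≤ m → m ≤ n → pred m < n
pred-<-pos (s≤s z≤n) m≤n = m≤n

-- The same for a map on the natural numbers injective on {1..n} and
-- mapping it into itself, transported along j ↦ j - 1.
range-injective⇒surjective : ∀ n (f : ℕ → ℕ) →
  (∀ i → 1 ≤ i → i ≤ n → 1 ≤ f i × f i ≤ n) →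
  (∀ i j → 1 ≤ i → i ≤ n → 1 ≤ j → j ≤ n → f i ≡ f j → i ≡ j) →
  ∀ p → 1 ≤ p → p ≤ n → Σ ℕ λ j → 1 ≤ j × j ≤ n × f j ≡ p
range-injective⇒surjective n f into inj p 1≤p p≤n = suc (toℕ x) , s≤s z≤n , toℕ<n x , f-eq
  where
    1≤f : (x : Fin n) → 1 ≤ f (suc (toℕ x))
    1≤f x = proj₁ (into (suc (toℕ x)) (s≤s z≤n) (toℕ<n x))

    g-bound : (x : Fin n) → pred (f (suc (toℕ x))) < n
    g-bound x = pred-<-pos (1≤f x) (proj₂ (into (suc (toℕ x)) (s≤s z≤n) (toℕ<n x)))

    g : Fin n → Fin n
    g x = fromℕ< (g-bound x)

    toℕ-g : ∀ x → toℕ (g x) ≡ pred (f (suc (toℕ x)))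
    toℕ-g x = toℕ-fromℕ< (g-bound x)

    g-injective : Injective _≡_ _≡_ g
    g-injective {x} {x′} e =
      toℕ-injective (suc-injective (inj _ _ (s≤s z≤n) (toℕ<n x) (s≤s z≤n) (toℕ<n x′)
        (pred-injective-pos (1≤f x) (1≤f x′)
          (trans (sym (toℕ-g x)) (trans (cong toℕ e) (toℕ-g x′))))))

    p-1<n : pred p < n
    p-1<n = pred-<-pos 1≤p p≤n

    preimage : ∃ λ x → g x ≡ fromℕ< p-1<n
    preimage = fin-injective⇒surjective g g-injective (fromℕ< p-1<n)

    x : Fin n
    x = proj₁ preimage

    f-eq : f (suc (toℕ x)) ≡ p
    f-eq = pred-injective-pos (1≤f x) 1≤p
             (trans (sym (toℕ-g x)) (trans (cong toℕ (proj₂ preimage)) (toℕ-fromℕ< p-1<n)))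

-- Maximal runs of a decidable predicate

Throughout : (ℕ → Set) → ℕ → ℕ → Set
Throughout P a b = ∀ m → a ≤ m → m ≤ b → P m

module _ {P : ℕ → Set} where

  throughout-single : ∀ {a} → P a → Throughout P a a
  throughout-single pa m a≤m m≤a = subst P (≤-antisym a≤m m≤a) pa

  throughout-snoc : ∀ {a b} → Throughout P a b → P (suc b) → Throughout P a (suc b)
  throughout-snoc run pb+1 m a≤m m≤b+1 with m≤n⇒m<n∨m≡n m≤b+1
  ... | inj₁ (s≤s m≤b) = run m a≤m m≤b
  ... | inj₂ refl = pb+1

  throughout-cons : ∀ {a b} → P a → Throughout P (suc a) b → Throughout P a b
  throughout-cons pa run m a≤m m≤b with m≤n⇒m<n∨m≡n a≤m
  ... | inj₁ a<m = run m a<m m≤b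
  ... | inj₂ refl = pa

  throughout-join : ∀ {a j b} → Throughout P a j → Throughout P j b → Throughout P a b
  throughout-join {j = j} left right m a≤m m≤b with m ≤? j
  ... | yes m≤j = left m a≤m m≤j
  ... | no m≰j = right m (<⇒≤ (≰⇒> m≰j)) m≤b

  throughout-induction : ∀ {a b} → P a → (∀ m → a ≤ m → m < b → P m → P (suc m)) →
                         Throughout P a b
  throughout-induction pa step zero a≤0 _ = subst P (n≤0⇒n≡0 a≤0) pa
  throughout-induction pa step (suc m) a≤m+1 m+1≤b with m≤n⇒m<n∨m≡n a≤m+1
  ... | inj₂ refl = pa
  ... | inj₁ (s≤s a≤m) = step m a≤m m+1≤b (throughout-induction pa step m a≤m (<⇒≤ m+1≤b))

  record MaximalRun (lo hi i b : ℕ) : Set where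
    field
      lo≤i     : lo ≤ i
      i≤b      : i ≤ b
      b≤hi     : b ≤ hi
      holds    : Throughout P i b
      leftEnd  : i ≡ lo ⊎ ¬ P (pred i)
      rightEnd : b ≡ hi ⊎ ¬ P (suc b)

  module _ (P? : Decidable P) where

    extend-left : ∀ d i → P (d + i) →
      Σ ℕ λ a → i ≤ a × a ≤ d + i × Throughout P a (d + i) × (a ≡ i ⊎ ¬ P (pred a))
    extend-left zero i p = i , ≤-refl , ≤-refl , throughout-single p , inj₁ refl
    extend-left (suc d) i p with P? (d + i)
    ... | no ¬p = suc (d + i) , m≤n⇒m≤1+n (m≤n+m i d) , ≤-refl , throughout-single p , inj₂ ¬p
    ... | yes p′ with extend-left d i p′
    ... | a , i≤a , a≤ , run , end = a , i≤a , m≤n⇒m≤1+n a≤ , throughout-snoc run p , end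

    extend-right : ∀ d j → P j →
      Σ ℕ λ b → j ≤ b × b ≤ d + j × Throughout P j b × (b ≡ d + j ⊎ ¬ P (suc b))
    extend-right zero j p = j , ≤-refl , ≤-refl , throughout-single p , inj₁ refl
    extend-right (suc d) j p with P? (suc j)
    ... | no ¬p = j , ≤-refl , m≤n+m j (suc d) , throughout-single p , inj₂ ¬p
    ... | yes p′ with extend-right d (suc j) p′
    ... | b , j<b , b≤ , run , end rewrite +-suc d j =
          b , <⇒≤ j<b , b≤ , throughout-cons p run , end

    maximal-run : ∀ {lo hi j} → lo ≤ j → j ≤ hi → P j →
                  Σ ℕ λ i → Σ ℕ λ b → i ≤ j × j ≤ b × MaximalRun lo hi i b
    maximal-run {lo} {hi} {j} lo≤j j≤hi pj
      with extend-left (j ∸ lo) lo (subst P (sym (m∸n+n≡m lo≤j)) pj)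
         | extend-right (hi ∸ j) j pj
    ... | i , lo≤i , i≤j′ , runˡ , endˡ | b , j≤b , b≤hi′ , runʳ , endʳ =
      i , b , i≤j , j≤b , record
        { lo≤i = lo≤i
        ; i≤b = ≤-trans i≤j j≤b
        ; b≤hi = subst (b ≤_) j+d≡hi b≤hi′
        ; holds = throughout-join runˡ′ runʳ
        ; leftEnd = endˡ
        ; rightEnd = map₁ (λ e → trans e j+d≡hi) endʳ
        }
      where
        i≤j : i ≤ j
        i≤j = subst (i ≤_) (m∸n+n≡m lo≤j) i≤j′
        j+d≡hi : hi ∸ j + j ≡ hi
        j+d≡hi = m∸n+n≡m j≤hi
        runˡ′ : Throughout P i j
        runˡ′ = subst (Throughout P i) (m∸n+n≡m lo≤j) runˡ

i+[2+l] : ∀ i l → i + suc (suc l) ≡ suc (suc (i + l))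
i+[2+l] i l = trans (+-suc i (suc l)) (cong suc (+-suc i l))

last-index : ∀ i l → i + suc (suc l) ∸ 1 ≡ suc (i + l)
last-index i l = cong (_∸ 1) (i+[2+l] i l)

penultimate-index : ∀ i l → i + suc (suc l) ∸ 2 ≡ i + l
penultimate-index i l = cong (_∸ 2) (i+[2+l] i l)

-- Runs of equal LCP values in a suffix array

module SuffixArrayRuns {A : Set} (_≺_ : Rel A 0ℓ) (sto : IsStrictTotalOrder _≡_ _≺_)
                       (w : List A) (r : ℕ → ℕ) (sa : IsSuffixArray _≺_ w r) where

  open IsSuffixArray sa
  open IsStrictTotalOrder sto using () renaming (_≟_ to _≟ₐ_; irrefl to ≺-irrefl; trans to ≺-trans)

  n : ℕ
  n = length w

  S : ℕ → List A
  S j = suffix w (r j)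

  L : ℕ → ℕ
  L = LCP _≟ₐ_ w r

  occurrence⇒prefix : ∀ {u p} → OccursAt w u p → 1 ≤ p × p ≤ n × u ≼ suffix w p
  occurrence⇒prefix (1≤p , p≤n , _ , e) = 1≤p , p≤n , take⇒prefix e

  prefix⇒occurrence : ∀ {u p} → 1 ≤ p → p ≤ n → u ≼ suffix w p → OccursAt w u p
  prefix⇒occurrence {u} {suc p} 1≤p p<n pre = 1≤p , p<n , fits , prefix⇒take pre
    where
      open ≤-Reasoning
      fits : p + length u ≤ n
      fits = begin
        p + length u      ≤⟨ +-monoʳ-≤ p (≤-trans (length-mono pre) (≤-reflexive (length-drop p w))) ⟩
        p + (n ∸ p)       ≡⟨ m+[n∸m]≡n (<⇒≤ p<n) ⟩
        n                 ∎

  -- Occurrences of u are exactly the positions r j of the indices j with u ≼ S j;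
  -- the converse direction uses that r is onto {1..n}.
  index⇒occurrence : ∀ {u j} → 1 ≤ j → j ≤ n → u ≼ S j → OccursAt w u (r j)
  index⇒occurrence 1≤j j≤n pre = prefix⇒occurrence (proj₁ (range _ 1≤j j≤n)) (proj₂ (range _ 1≤j j≤n)) pre

  occurrence⇒index : ∀ {u p} → OccursAt w u p → Σ ℕ λ j → 1 ≤ j × j ≤ n × r j ≡ p × u ≼ S j
  occurrence⇒index {u} occ with occurrence⇒prefix occ
  ... | 1≤p , p≤n , pre with range-injective⇒surjective n r range inj _ 1≤p p≤n
  ... | j , 1≤j , j≤n , rj≡p = j , 1≤j , j≤n , rj≡p , subst (λ q → u ≼ suffix w q) (sym rj≡p) pre

  r-adjacent-distinct : ∀ {m} → 1 ≤ m → suc m ≤ n → r m ≢ r (suc m)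
  r-adjacent-distinct {m} 1≤m m<n e = <-irrefl (inj _ _ 1≤m (<⇒≤ m<n) (s≤s z≤n) m<n e) (n<1+n m)

  -- The indices whose suffixes start with t form an interval, since the
  -- suffixes are sorted.
  prefix-convex : ∀ {t a b c} → 1 ≤ a → a ≤ b → b ≤ c → c ≤ n → t ≼ S a → t ≼ S c → t ≼ S b
  prefix-convex 1≤a a≤b b≤c c≤n pa pc with m≤n⇒m<n∨m≡n a≤b | m≤n⇒m<n∨m≡n b≤c
  ... | inj₂ refl | _ = pa
  ... | inj₁ _ | inj₂ refl = pc
  ... | inj₁ a<b | inj₁ b<c = prefix-between ≺-irrefl ≺-trans pa pc
          (sorted _ _ 1≤a a<b (≤-trans (<⇒≤ b<c) c≤n)) (sorted _ _ (≤-trans 1≤a a≤b) b<c c≤n)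

  blocked-after : ∀ {u m} → u ≼ S m → ((¬ u ≼ S (suc m)) ⇔ L m < length u)
  blocked-after pm = mk⇔ (λ ¬next → ≰⇒> (λ le → ¬next (lcp-transferʳ _≟ₐ_ pm le)))
                         (λ lt next → <⇒≱ lt (lcp-greatest _≟ₐ_ pm next))

  blocked-before : ∀ {u m} → 1 ≤ m → u ≼ S m → ((¬ u ≼ S (pred m)) ⇔ L (pred m) < length u)
  blocked-before (s≤s z≤n) pm = mk⇔ (λ ¬prev → ≰⇒> (λ le → ¬prev (lcp-transferˡ _≟ₐ_ pm le)))
                                     (λ lt prev → <⇒≱ lt (lcp-greatest _≟ₐ_ prev pm))

  Run : List A → ℕ → ℕ → Set
  Run u = MaximalRun {P = λ m → u ≼ S m} 1 n

  run-contains : ∀ {u i b j} → Run u i b → 1 ≤ j → j ≤ n → u ≼ S j → i ≤ j × j ≤ b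
  run-contains {u} {i} {b} {j} run 1≤j j≤n pj = i≤j , j≤b
    where
      open MaximalRun run
      i≤j : i ≤ j
      i≤j with i ≤? j | leftEnd
      ... | yes i≤j | _ = i≤j
      ... | no i≰j | inj₁ i≡1 = contradiction (subst (_≤ j) (sym i≡1) 1≤j) i≰j
      ... | no i≰j | inj₂ ¬prev = contradiction
            (prefix-convex 1≤j (<⇒≤pred (≰⇒> i≰j)) pred[n]≤n (≤-trans i≤b b≤hi) pj (holds i ≤-refl i≤b)) ¬prev
      j≤b : j ≤ b
      j≤b with j ≤? b | rightEnd
      ... | yes j≤b | _ = j≤b
      ... | no j≰b | inj₁ b≡n = contradiction (subst (j ≤_) (sym b≡n) j≤n) j≰b
      ... | no j≰b | inj₂ ¬next = contradiction
            (prefix-convex (≤-trans lo≤i i≤b) (n≤1+n b) (≰⇒> j≰b) j≤n (holds b i≤b ≤-refl) pj) ¬next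

  -- If no proper extension of u occurs twice, then LCP[m] ≤ |u| for each
  -- index m with u ≼ S m: otherwise the common prefix of S m and S (m+1)
  -- would be a proper extension of u occurring at r m and r (m+1).
  lcp-bounded : ∀ {u m} → (∀ v → v ≢ [] → OccursAtMostOnce w (u ++ v)) →
                1 ≤ m → suc m ≤ n → u ≼ S m → L m ≤ length u
  lcp-bounded {u} {m} once 1≤m m<n pm = ≮⇒≥ longer⇒⊥
    where
      c : List A
      c = commonPrefix _≟ₐ_ (S m) (S (suc m))

      |c|≡L : length c ≡ L m
      |c|≡L = length-commonPrefix _≟ₐ_ (S m) (S (suc m))

      longer⇒⊥ : ¬ (length u < L m)
      longer⇒⊥ u<L with proper-extension u≼c (subst (length u <_) (sym |c|≡L) u<L)
        where
          u≼c : u ≼ c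
          u≼c = prefix-comparable pm (take-prefix (L m) (S m))
                  (subst (length u ≤_) (sym |c|≡L) (<⇒≤ u<L))
      ... | s , s≢[] , c≡u++s = r-adjacent-distinct 1≤m m<n (once s s≢[] _ _ occ₁ occ₂)
        where
          occ₁ : OccursAt w (u ++ s) (r m)
          occ₁ = subst (λ x → OccursAt w x (r m)) c≡u++s
                   (index⇒occurrence 1≤m (<⇒≤ m<n) (take-prefix (L m) (S m)))
          occ₂ : OccursAt w (u ++ s) (r (suc m))
          occ₂ = subst (λ x → OccursAt w x (r (suc m))) c≡u++s
                   (index⇒occurrence (s≤s z≤n) m<n (commonPrefix-right _≟ₐ_ (S m) (S (suc m))))

  -- The paper's condition on the indices i < b (where b = i + k - 1): u is
  -- the common prefix of S i .. S b, LCP is constant on [i, b) and drops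
  -- strictly just before i and at b.
  record LCPRun (u : List A) (i b : ℕ) : Set where
    field
      1≤i       : 1 ≤ i
      i<b       : i < b
      b≤n       : b ≤ n
      label     : u ≡ take (L i) (S i)
      flat      : ∀ j → i ≤ j → j < b → L j ≡ L i
      dropLeft  : i ≡ 1 ⊎ L (pred i) < L i
      dropRight : b ≡ n ⊎ L b < L i

  -- Supermaximal repeats give LCP runs: take the maximal run [i, b] of u
  -- around one occurrence; it contains the other occurrence, so i < b, and
  -- LCP equals |u| on [i, b) by lcp-bounded.
  supermaximal⇒run : ∀ {u} → SupermaximalRight w u → Σ ℕ λ i → Σ ℕ λ b → LCPRun u i b
  supermaximal⇒run {u} ((p , q , p≢q , occ-p , occ-q) , once)
    with occurrence⇒index occ-p | occurrence⇒index occ-q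
  ... | j₀ , 1≤j₀ , j₀≤n , rj₀≡p , pj₀ | j₁ , 1≤j₁ , j₁≤n , rj₁≡q , pj₁
    with maximal-run (λ m → prefix? _≟ₐ_ u (S m)) 1≤j₀ j₀≤n pj₀
  ... | i , b , i≤j₀ , j₀≤b , run = i , b , record
        { 1≤i = lo≤i
        ; i<b = i<b
        ; b≤n = b≤hi
        ; label = subst (λ ℓ → u ≡ take ℓ (S i)) (sym Li≡|u|) (prefix⇒take (holds i ≤-refl i≤b))
        ; flat = λ j i≤j j<b → trans (flat-u j i≤j j<b) (sym Li≡|u|)
        ; dropLeft = map₂ (λ ¬prev → subst (L (pred i) <_) (sym Li≡|u|)
                            (Equivalence.to (blocked-before lo≤i (holds i ≤-refl i≤b)) ¬prev)) leftEnd
        ; dropRight = map₂ (λ ¬next → subst (L b <_) (sym Li≡|u|)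
                             (Equivalence.to (blocked-after (holds b i≤b ≤-refl)) ¬next)) rightEnd
        }
    where
      open MaximalRun run

      j₁-in-run : i ≤ j₁ × j₁ ≤ b
      j₁-in-run = run-contains run 1≤j₁ j₁≤n pj₁

      -- a one-point run would force both occurrences to coincide
      i<b : i < b
      i<b with m≤n⇒m<n∨m≡n i≤b
      ... | inj₁ i<b = i<b
      ... | inj₂ i≡b = contradiction (trans (sym rj₀≡p) (trans (cong r j₀≡j₁) rj₁≡q)) p≢q
        where
          squeeze : ∀ {j} → i ≤ j → j ≤ b → j ≡ i
          squeeze i≤j j≤b = ≤-antisym (subst (_ ≤_) (sym i≡b) j≤b) i≤j
          j₀≡j₁ : j₀ ≡ j₁
          j₀≡j₁ = trans (squeeze i≤j₀ j₀≤b) (sym (squeeze (proj₁ j₁-in-run) (proj₂ j₁-in-run)))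

      flat-u : ∀ j → i ≤ j → j < b → L j ≡ length u
      flat-u j i≤j j<b =
        ≤-antisym (lcp-bounded once (≤-trans lo≤i i≤j) (≤-trans j<b b≤hi) (holds j i≤j (<⇒≤ j<b)))
                  (lcp-greatest _≟ₐ_ (holds j i≤j (<⇒≤ j<b)) (holds (suc j) (m≤n⇒m≤1+n i≤j) j<b))

      Li≡|u| : L i ≡ length u
      Li≡|u| = flat-u i ≤-refl i<b

  -- LCP runs give supermaximal repeats: u starts exactly the suffixes of
  -- the run, so it occurs at r i and r (i+1); a proper extension t of u
  -- starting S j and S j′ with j < j′ in the run would also start S (j+1),
  -- forcing |t| ≤ LCP[j] = |u|.
  run⇒supermaximal : ∀ {u i b} → LCPRun u i b → SupermaximalRight w u
  run⇒supermaximal {u} {i} {b} lr =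
    (r i , r (suc i) , r-adjacent-distinct 1≤i i+1≤n ,
       index⇒occurrence 1≤i (<⇒≤ i+1≤n) pi , index⇒occurrence (s≤s z≤n) i+1≤n (inside (suc i) (n≤1+n i) i<b)) ,
    at-most-once
    where
      open LCPRun lr

      i+1≤n : suc i ≤ n
      i+1≤n = ≤-trans i<b b≤n

      |u|≡Li : length u ≡ L i
      |u|≡Li = trans (cong length label) (length-commonPrefix _≟ₐ_ (S i) (S (suc i)))

      pi : u ≼ S i
      pi = subst (_≼ S i) (sym label) (take-prefix (L i) (S i))

      inside : Throughout (λ m → u ≼ S m) i b
      inside = throughout-induction pi
        (λ m i≤m m<b pm → lcp-transferʳ _≟ₐ_ pm (≤-reflexive (trans |u|≡Li (sym (flat m i≤m m<b)))))

      run : Run u i b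
      run = record
        { lo≤i = 1≤i
        ; i≤b = <⇒≤ i<b
        ; b≤hi = b≤n
        ; holds = inside
        ; leftEnd = map₂ (λ lt → Equivalence.from (blocked-before 1≤i pi) (subst (L (pred i) <_) (sym |u|≡Li) lt)) dropLeft
        ; rightEnd = map₂ (λ lt → Equivalence.from (blocked-after (inside b (<⇒≤ i<b) ≤-refl)) (subst (L b <_) (sym |u|≡Li) lt)) dropRight
        }

      two-indices⇒⊥ : ∀ {t j j′} → u ≼ t → length u < length t → 1 ≤ j → j < j′ → j′ ≤ n →
                      t ≼ S j → t ≼ S j′ → ⊥
      two-indices⇒⊥ {t} {j} {j′} u≼t |u|<|t| 1≤j j<j′ j′≤n tj tj′ =
        <⇒≱ |u|<|t| (subst (length t ≤_) Lj≡|u| (lcp-greatest _≟ₐ_ tj tj+1))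
        where
          tj+1 : t ≼ S (suc j)
          tj+1 = prefix-convex 1≤j (n≤1+n j) j<j′ j′≤n tj tj′
          i≤j : i ≤ j
          i≤j = proj₁ (run-contains run 1≤j (≤-trans (<⇒≤ j<j′) j′≤n) (prefix-trans trans u≼t tj))
          j′≤b : j′ ≤ b
          j′≤b = proj₂ (run-contains run (≤-trans 1≤j (<⇒≤ j<j′)) j′≤n (prefix-trans trans u≼t tj′))
          Lj≡|u| : L j ≡ length u
          Lj≡|u| = trans (flat j i≤j (≤-trans j<j′ j′≤b)) (sym |u|≡Li)

      at-most-once : ∀ v → v ≢ [] → OccursAtMostOnce w (u ++ v)
      at-most-once v v≢[] p q occ-p occ-q
        with occurrence⇒index occ-p | occurrence⇒index occ-q
      ... | j , 1≤j , j≤n , rj≡p , tj | j′ , 1≤j′ , j′≤n , rj′≡q , tj′ with <-cmp j j′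
      ... | tri< j<j′ _ _ = ⊥-elim (two-indices⇒⊥ (prefix-++ u v) (++-longer u v≢[]) 1≤j j<j′ j′≤n tj tj′)
      ... | tri≈ _ j≡j′ _ = trans (sym rj≡p) (trans (cong r j≡j′) rj′≡q)
      ... | tri> _ _ j′<j = ⊥-elim (two-indices⇒⊥ (prefix-++ u v) (++-longer u v≢[]) 1≤j′ j′<j j≤n tj′ tj)

  PaperRun : List A → Set
  PaperRun u = Σ ℕ λ i → Σ ℕ λ k → 1 ≤ i × 2 ≤ k × i + k ∸ 1 ≤ n
    × u ≡ take (L i) (suffix w (r i))
    × (∀ j → i ≤ j → j ≤ i + k ∸ 2 → L j ≡ L i)
    × (i ≡ 1 ⊎ L (i ∸ 1) < L i)
    × (i + k ∸ 1 ≡ n ⊎ L (i + k ∸ 1) < L i)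

  -- A run on [i, b] is the paper's run with k = b - i + 1 = (b - 1 - i) + 2.
  run⇒paper : ∀ {u i b} → LCPRun u i b → PaperRun u
  run⇒paper {b = zero} lr = contradiction (LCPRun.i<b lr) n≮0
  run⇒paper {u} {i} {suc b′} lr =
    i , suc (suc l) , 1≤i , s≤s (s≤s z≤n) , subst (_≤ n) (sym last) b≤n , label , flat′ , dropLeft ,
    subst (λ x → x ≡ n ⊎ L x < L i) (sym last) dropRight
    where
      open LCPRun lr
      l : ℕ
      l = b′ ∸ i
      i+l≡b′ : i + l ≡ b′
      i+l≡b′ = m+[n∸m]≡n (≤-pred i<b)
      last : i + suc (suc l) ∸ 1 ≡ suc b′
      last = trans (last-index i l) (cong suc i+l≡b′)
      flat′ : ∀ j → i ≤ j → j ≤ i + suc (suc l) ∸ 2 → L j ≡ L i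
      flat′ j i≤j j≤ = flat j i≤j (s≤s (subst (j ≤_) (trans (penultimate-index i l) i+l≡b′) j≤))

  paper⇒run : ∀ {u} → PaperRun u → Σ ℕ λ i → Σ ℕ λ b → LCPRun u i b
  paper⇒run (_ , zero , _ , () , _)
  paper⇒run (_ , suc zero , _ , s≤s () , _)
  paper⇒run (i , suc (suc l) , 1≤i , _ , end , label , flat , dropLeft , dropRight) =
    i , i + suc (suc l) ∸ 1 , record
      { 1≤i = 1≤i
      ; i<b = subst (i <_) (sym (last-index i l)) (s≤s (m≤m+n i l))
      ; b≤n = end
      ; label = label
      ; flat = λ j i≤j j<b → flat j i≤j
                 (subst (j ≤_) (sym (penultimate-index i l)) (≤-pred (subst (j <_) (last-index i l) j<b)))
      ; dropLeft = dropLeft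
      ; dropRight = dropRight
      }

  supermaximal⇔paper-run : ∀ u → SupermaximalRight w u ⇔ PaperRun u
  supermaximal⇔paper-run u = mk⇔ (λ sm → let (_ , _ , lr) = supermaximal⇒run sm in run⇒paper lr)
                                 (λ pr → let (_ , _ , lr) = paper⇒run pr in run⇒supermaximal lr)

proposition7 : {A : Set} (_≺_ : Rel A 0ℓ) (sto : IsStrictTotalOrder _≡_ _≺_)
  (w : List A) (r : ℕ → ℕ) → IsSuffixArray _≺_ w r →
  let n = length w
      L = LCP (IsStrictTotalOrder._≟_ sto) w r
  in (u : List A) → IsSubstring u w →
  SupermaximalRight w u ⇔
    (Σ ℕ λ i → Σ ℕ λ k → 1 ≤ i × 2 ≤ k × i + k ∸ 1 ≤ n
      × u ≡ take (L i) (suffix w (r i))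
      × (∀ j → i ≤ j → j ≤ i + k ∸ 2 → L j ≡ L i)
      × (i ≡ 1 ⊎ L (i ∸ 1) < L i)
      × (i + k ∸ 1 ≡ n ⊎ L (i + k ∸ 1) < L i))
proposition7 _≺_ sto w r sa u _ = SuffixArrayRuns.supermaximal⇔paper-run _≺_ sto w r sa u
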